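{- Let $G\in\mathcal{C}$ be connected and let $o$ be an extremal orientation of $G$. Then there is at most one vertex $v$ with $d^o_+(v)=0$.
   Context: All graphs are finite and simple. $\mathcal{C}$ is the class of graphs in which every connected component contains a cycle. An orientation $o$ of $G$ is valid if every vertex has in-degree at least $1$. For a directed graph, a total dominating set is a set $S$ such that every vertex has an in-neighbor in $S$, and $\gamma_t$ is the minimum size of such a set. A valid orientation $o$ of a connected graph $G\in\mathcal{C}$ is extremal if its total domination number equals $|V(G)|-1$. $d^o_+(v)$ is the out-degree of $v$ in $o$. -}

module Defs where

open import Data.Nat using (ℕ; zero; suc; _∸_; _≤_)
open import Data.Bool using (Bool; true; false; T)
open import Data.Fin using (Fin; zero; suc; inject₁; fromℕ)
open import Data.Fin.Subset using (Subset; _∈_; ∣_∣)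
open import Data.Vec using (tabulate)
open import Data.Product using (Σ; ∃; _×_; _,_)
open import Data.Sum using (_⊎_)
open import Relation.Binary.PropositionalEquality using (_≡_)
open import Relation.Nullary using (¬_)
open import Function.Definitions using (Injective)

record Graph (n : ℕ) : Set where
  field
    adj     : Fin n → Fin n → Bool
    symm    : ∀ u v → adj u v ≡ adj v u
    irrefl  : ∀ v → adj v v ≡ false
open Graph public

data Walk {n : ℕ} (G : Graph n) : Fin n → Fin n → Set where
  here : ∀ {u} → Walk G u u
  step : ∀ {u w v} → T (adj G u w) → Walk G w v → Walk G u v

Connected : {n : ℕ} → Graph n → Set
Connected {n} G = ∀ (u v : Fin n) → Walk G u v

-- A cycle of length k+3: an injective cyclic sequence of vertices,
-- consecutive ones (including last–first) adjacent.
HasCycle : {n : ℕ} → Graph n → Set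
HasCycle {n} G =
  Σ ℕ λ k → Σ (Fin (suc (suc (suc k))) → Fin n) λ c →
    Injective _≡_ _≡_ c
    × (∀ (i : Fin (suc (suc k))) → T (adj G (c (inject₁ i)) (c (suc i))))
    × T (adj G (c (fromℕ (suc (suc k)))) (c zero))

record Orientation {n : ℕ} (G : Graph n) : Set where
  field
    arc      : Fin n → Fin n → Bool
    arc-edge : ∀ u v → T (arc u v) → T (adj G u v)
    arc-one  : ∀ u v → T (adj G u v) →
                 (T (arc u v) × ¬ T (arc v u)) ⊎ (T (arc v u) × ¬ T (arc u v))
open Orientation public

outdeg : {n : ℕ} {G : Graph n} → Orientation G → Fin n → ℕ
outdeg o v = ∣ tabulate (arc o v) ∣

Valid : {n : ℕ} {G : Graph n} → Orientation G → Set
Valid {n} o = ∀ (v : Fin n) → ∃ λ u → T (arc o u v)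

IsTDS : {n : ℕ} {G : Graph n} → Orientation G → Subset n → Set
IsTDS {n} o S = ∀ (v : Fin n) → ∃ λ u → u ∈ S × T (arc o u v)

TotalDomNumberIs : {n : ℕ} {G : Graph n} → Orientation G → ℕ → Set
TotalDomNumberIs {n} o k =
  (∃ λ S → IsTDS o S × ∣ S ∣ ≡ k) × (∀ S → IsTDS o S → k ≤ ∣ S ∣)

Extremal : {n : ℕ} {G : Graph n} → Orientation G → Set
Extremal {n} o = Valid o × TotalDomNumberIs o (n ∸ 1)

{-# OPTIONS --safe #-}
module Submission where

open import Defs
open import Data.Nat using (ℕ; _+_; _≤_; _<_; s≤s)
open import Data.Nat.Properties using (≤-trans; <⇒≱; n≮0; ∸-monoˡ-≤)
open import Data.Fin using (Fin; _≟_)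
open import Data.Fin.Subset using (Subset; _∈_; _∉_; ∣_∣; ⊤; _-_)
open import Data.Fin.Subset.Properties using (∈⊤; ∣⊤∣≡n; x∈p∧x≢y⇒x∈p-y; x∈p⇒∣p-x∣<∣p∣)
open import Data.Vec using (tabulate)
open import Data.Vec.Properties using (lookup⇒[]=; lookup∘tabulate)
open import Data.Bool using (Bool; T)
open import Data.Bool.Properties using (T-≡)
open import Data.Product using (_,_)
open import Function.Bundles using (Equivalence)
open import Relation.Nullary using (¬_; yes; no; contradiction)
open import Relation.Binary.PropositionalEquality using (_≡_; _≢_; refl; sym; trans; subst)

-- So V ∖ {u, v}, of size n − 2, is a total dominating set,
-- contradicting γ_t = n − 1.

T⇒∈tabulate : ∀ {n} (f : Fin n → Bool) {x : Fin n} → T (f x) → x ∈ tabulate f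
T⇒∈tabulate f {x} fx =
  lookup⇒[]= x (tabulate f) (trans (lookup∘tabulate f x) (Equivalence.to T-≡ fx))

∣p∣≡0⇒x∉p : ∀ {n} {p : Subset n} {x : Fin n} → ∣ p ∣ ≡ 0 → x ∉ p
∣p∣≡0⇒x∉p {p = p} {x} ∣p∣≡0 x∈p = n≮0 (subst (∣ p - x ∣ <_) ∣p∣≡0 (x∈p⇒∣p-x∣<∣p∣ x∈p))

2+∣p-x-y∣≤∣p∣ : ∀ {n} {p : Subset n} {x y : Fin n} →
  x ∈ p → y ∈ p → x ≢ y → 2 + ∣ p - x - y ∣ ≤ ∣ p ∣
2+∣p-x-y∣≤∣p∣ x∈p y∈p x≢y =
  ≤-trans (s≤s (x∈p⇒∣p-x∣<∣p∣ (x∈p∧x≢y⇒x∈p-y y∈p (λ y≡x → x≢y (sym y≡x))))) (x∈p⇒∣p-x∣<∣p∣ x∈p)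

module _ {n : ℕ} {G : Graph n} (o : Orientation G) where

  outdeg≡0⇒¬arc : ∀ {u w} → outdeg o u ≡ 0 → ¬ T (arc o u w)
  outdeg≡0⇒¬arc u-sink uw = ∣p∣≡0⇒x∉p u-sink (T⇒∈tabulate (arc o _) uw)

  ⊇tails⇒IsTDS : Valid o → ∀ {S} → (∀ {u w} → T (arc o u w) → u ∈ S) → IsTDS o S
  ⊇tails⇒IsTDS valid tails⊆S w with valid w
  ... | u , uw = u , tails⊆S uw , uw

  IsTDS-without-sinks : Valid o → ∀ {u v} → outdeg o u ≡ 0 → outdeg o v ≡ 0 →
    IsTDS o (⊤ - u - v)
  IsTDS-without-sinks valid {u} {v} u-sink v-sink = ⊇tails⇒IsTDS valid tail∈S
    where
    tail∈S : ∀ {x w} → T (arc o x w) → x ∈ ⊤ - u - v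
    tail∈S xw = x∈p∧x≢y⇒x∈p-y (x∈p∧x≢y⇒x∈p-y ∈⊤ λ { refl → outdeg≡0⇒¬arc u-sink xw })
                                                  λ { refl → outdeg≡0⇒¬arc v-sink xw }

mainTheorem6 : ∀ {n : ℕ} (G : Graph n) → Connected G → HasCycle G →
    (o : Orientation G) → Extremal o →
    ∀ (u v : Fin n) → outdeg o u ≡ 0 → outdeg o v ≡ 0 → u ≡ v
mainTheorem6 {n} G _ _ o (valid , _ , minimal) u v u-sink v-sink with u ≟ v
... | yes u≡v = u≡v
... | no u≢v = contradiction (minimal _ (IsTDS-without-sinks o valid u-sink v-sink))
                             (<⇒≱ (∸-monoˡ-≤ 1 size))
  where
  size : 2 + ∣ ⊤ - u - v ∣ ≤ n
  size = subst (2 + ∣ ⊤ - u - v ∣ ≤_) (∣⊤∣≡n n) (2+∣p-x-y∣≤∣p∣ ∈⊤ ∈⊤ u≢v)
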